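{- Let $H_i, H_{i+1}$ be graphs such that the pair $(H_i, H_{i+1})$ is ascending, and let $M_i \subseteq H_i$ and $M_{i+1} \subseteq H_{i+1}$ be isolated matchings (in $H_i$ and $H_{i+1}$ respectively). Suppose that either $e(H_{i+1} \setminus M_{i+1}) = e(H_i \setminus M_i) + 1$, or $e(H_{i+1} \setminus M_{i+1}) = e(H_i \setminus M_i)$ and $H_{i+1} \cong H_i$. Then $(H_i \setminus M_i, H_{i+1} \setminus M_{i+1})$ is ascending.
   Context: An ordered pair of graphs $(A, B)$ is ascending if $A \cong B$ or $A \cong B \setminus e$ for some edge $e$ of $B$. A matching $M \subseteq H$ is isolated if no edge of $M$ shares a vertex with any other edge of $H$. $H \setminus M$ denotes $H$ with the edges of $M$ removed; $e(\cdot)$ is the number of edges. -}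

module Defs where

open import Data.Nat using (ℕ; zero; suc; _+_; _<ᵇ_)
open import Data.Bool using (Bool; true; false; _∧_; not; if_then_else_)
open import Data.Bool.Properties using (∧-comm)
open import Data.Fin using (Fin; toℕ) renaming (zero to fzero; suc to fsuc)
open import Data.Product using (Σ; _×_; _,_)
open import Data.Sum using (_⊎_)
open import Relation.Nullary using (Dec; yes; no)
open import Relation.Binary.PropositionalEquality using (_≡_; refl; cong₂; trans)
open import Function.Bundles using (_↔_; Inverse)
open import Data.Fin using (_≟_)

record Graph (n : ℕ) : Set where
  field
    adj    : Fin n → Fin n → Bool
    sym    : ∀ u v → adj u v ≡ adj v u
    irrefl : ∀ u → adj u u ≡ false
open Graph public

ΣFin : ∀ {n} → (Fin n → ℕ) → ℕ
ΣFin {zero}  f = 0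
ΣFin {suc n} f = f fzero + ΣFin (λ i → f (fsuc i))

e : ∀ {n} → Graph n → ℕ
e G = ΣFin (λ u → ΣFin (λ v →
        if adj G u v ∧ (toℕ u <ᵇ toℕ v) then 1 else 0))

_≅_ : ∀ {n m} → Graph n → Graph m → Set
_≅_ {n} {m} A B = Σ (Fin n ↔ Fin m) λ f →
  ∀ u v → adj A u v ≡ adj B (Inverse.to f u) (Inverse.to f v)

_⊆_ : ∀ {n} → Graph n → Graph n → Set
M ⊆ H = ∀ u v → adj M u v ≡ true → adj H u v ≡ true

_∖_ : ∀ {n} → Graph n → Graph n → Graph n
adj    (H ∖ M) u v = adj H u v ∧ not (adj M u v)
sym    (H ∖ M) u v = cong₂ (λ a b → a ∧ not b) (sym H u v) (sym M u v)
irrefl (H ∖ M) u rewrite irrefl H u = refl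

same : ∀ {n} → Fin n → Fin n → Bool
same u v with u ≟ v
... | yes _ = true
... | no  _ = false

delEdge : ∀ {n} → Graph n → Fin n → Fin n → Graph n
adj    (delEdge B x y) u v =
  adj B u v ∧ not ((same u x ∧ same v y) Data.Bool.∨ (same u y ∧ same v x))
sym    (delEdge B x y) u v rewrite sym B u v
  | Data.Bool.Properties.∨-comm (same u x ∧ same v y) (same u y ∧ same v x)
  | ∧-comm (same u x) (same v y) | ∧-comm (same u y) (same v x) = refl
irrefl (delEdge B x y) u rewrite irrefl B u = refl

Ascending : ∀ {n m} → Graph n → Graph m → Set
Ascending {n} {m} A B =
  (A ≅ B) ⊎ Σ (Fin m) λ x → Σ (Fin m) λ y → (adj B x y ≡ true) × (A ≅ delEdge B x y)

IsolatedMatching : ∀ {n} → Graph n → Graph n → Set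
IsolatedMatching H M = (M ⊆ H) ×
  (∀ u v x y → adj M u v ≡ true → adj H x y ≡ true →
     (x ≡ u ⊎ x ≡ v ⊎ y ≡ u ⊎ y ≡ v) →
     (x ≡ u × y ≡ v) ⊎ (x ≡ v × y ≡ u))

-- An isolated matching M of H consists of components of H that are single edges, so up to
-- isomorphism H ∖ M depends only on H and on the size of M: two isolated matchings of equal
-- size can be aligned edge by edge by automorphisms swapping two isolated edges. Transport M_i
-- along the isomorphism from H_i to H_{i+1} (or to H_{i+1} ∖ xy). The edge counts then force
-- the matchings to have equal size, or one of them to have exactly one extra edge, which plays
-- the role of the deleted edge; when H_i ≅ H_{i+1} ∖ xy, the edge xy is either absorbed into
-- M_{i+1} or is itself the deleted edge.
module Submission where

open import Algebra.Bundles using (CommutativeMonoid)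
open import Data.Bool using (Bool; true; false; _∧_; _∨_; not; if_then_else_)
import Data.Bool as Bool
open import Data.Bool.Properties
  using (∧-identityʳ; ∧-zeroʳ; ∨-identityʳ; ∧-comm; ∨-comm; ∧-commutativeMonoid; ¬-not; not-injective)
open import Data.Empty using (⊥)
open import Data.Fin using (Fin; toℕ; _≟_) renaming (zero to fzero; suc to fsuc)
import Data.Fin.Properties as Fin
open import Data.Nat using (ℕ; zero; suc; _+_; _<ᵇ_; ⌊_/2⌋; _≤_; _<_)
open import Data.Nat.Properties
  using (+-*-semiring; +-commutativeSemigroup; +-comm; +-identityʳ; +-cancelˡ-≡; suc-injective;
         m+n≡0⇒m≡0; m+n≡0⇒n≡0; n≡⌊n+n/2⌋; <ᵇ-reflects-<; <⇒≯; <⇒≱; ≮⇒≥; ≤-antisym; m≤n+m; n<1+n; 1+n≢n)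
open import Data.Product using (Σ; _×_; _,_; ∃₂; proj₁; proj₂)
open import Data.Sum using (_⊎_; inj₁; inj₂)
import Data.Sum as Sum
open import Function using (_∘_; _↔_; Inverse; mk↔ₛ′)
open import Function.Construct.Composition using (_↔-∘_)
open import Function.Construct.Identity using (↔-id)
open import Function.Construct.Symmetry using (↔-sym)
open import Relation.Binary.PropositionalEquality as ≡
  using (_≡_; _≢_; ≢-sym; refl; trans; cong; cong₂; subst; subst₂; module ≡-Reasoning)
open import Relation.Nullary using (yes; no; contradiction)
open import Relation.Nullary.Reflects using (ofʸ; ofⁿ)

open import Defs
open import Algebra.Properties.Semiring.Sum +-*-semiring
open import Algebra.Properties.CommutativeSemigroup +-commutativeSemigroup using (interchange; xy∙z≈y∙xz)
import Algebra.Properties.CommutativeSemigroup (CommutativeMonoid.commutativeSemigroup ∧-commutativeMonoid) as ∧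

-- Counting ordered pairs

𝟙 : Bool → ℕ
𝟙 b = if b then 1 else 0

-- Unlike e, which counts each edge once through the order of Fin, counting ordered pairs is
-- invariant under relabelling vertices; countPairs-adj relates the two.
countPairs : ∀ {n} → (Fin n → Fin n → Bool) → ℕ
countPairs {n} r = ∑[ u < n ] ∑[ v < n ] 𝟙 (r u v)

ΣFin≡sum : ∀ {n} (f : Fin n → ℕ) → ΣFin f ≡ sum f
ΣFin≡sum {zero}  f = refl
ΣFin≡sum {suc n} f = cong (f fzero +_) (ΣFin≡sum (f ∘ fsuc))

sum≡0⇒≡0 : ∀ {n} (f : Fin n → ℕ) → sum f ≡ 0 → ∀ i → f i ≡ 0
sum≡0⇒≡0 f Σf≡0 fzero    = m+n≡0⇒m≡0 (f fzero) Σf≡0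
sum≡0⇒≡0 f Σf≡0 (fsuc i) = sum≡0⇒≡0 (f ∘ fsuc) (m+n≡0⇒n≡0 (f fzero) Σf≡0) i

half-injective : ∀ {m n} → m + m ≡ n + n → m ≡ n
half-injective {m} {n} eq = begin
  m            ≡⟨ n≡⌊n+n/2⌋ m ⟩
  ⌊ m + m /2⌋  ≡⟨ cong ⌊_/2⌋ eq ⟩
  ⌊ n + n /2⌋  ≡⟨ n≡⌊n+n/2⌋ n ⟨
  n            ∎
  where open ≡-Reasoning

halve-sum : ∀ a b c → (a + a) + (b + b) ≡ c + c → a + b ≡ c
halve-sum a b c eq = half-injective (trans (interchange a b a b) eq)

module _ {n : ℕ} where

  countPairs-cong : {r s : Fin n → Fin n → Bool} → (∀ u v → r u v ≡ s u v) →
                    countPairs r ≡ countPairs s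
  countPairs-cong r≗s = sum-cong-≗ λ u → sum-cong-≗ λ v → cong 𝟙 (r≗s u v)

  countPairs-+ : {r s t : Fin n → Fin n → Bool} →
                 (∀ u v → 𝟙 (r u v) + 𝟙 (s u v) ≡ 𝟙 (t u v)) →
                 countPairs r + countPairs s ≡ countPairs t
  countPairs-+ {r} {s} {t} pointwise = begin
    countPairs r + countPairs s
      ≡⟨ ∑-distrib-+ (λ u → ∑[ v < n ] 𝟙 (r u v)) (λ u → ∑[ v < n ] 𝟙 (s u v)) ⟨
    ∑[ u < n ] (∑[ v < n ] 𝟙 (r u v) + ∑[ v < n ] 𝟙 (s u v))
      ≡⟨ sum-cong-≗ (λ u → ∑-distrib-+ (λ v → 𝟙 (r u v)) (λ v → 𝟙 (s u v))) ⟨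
    ∑[ u < n ] ∑[ v < n ] (𝟙 (r u v) + 𝟙 (s u v))
      ≡⟨ sum-cong-≗ (λ u → sum-cong-≗ (pointwise u)) ⟩
    countPairs t
      ∎
    where open ≡-Reasoning

  countPairs-∖ : (r s : Fin n → Fin n → Bool) → (∀ u v → s u v ≡ true → r u v ≡ true) →
                 countPairs (λ u v → r u v ∧ not (s u v)) + countPairs s ≡ countPairs r
  countPairs-∖ r s s⊆r = countPairs-+ λ u v → split (r u v) (s u v) (s⊆r u v)
    where
    split : ∀ p q → (q ≡ true → p ≡ true) → 𝟙 (p ∧ not q) + 𝟙 q ≡ 𝟙 p
    split p     false _   = trans (+-identityʳ _) (cong 𝟙 (∧-identityʳ p))
    split true  true  _   = refl
    split false true  q⇒p = contradiction (q⇒p refl) λ ()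

  countPairs-transpose : (r : Fin n → Fin n → Bool) → countPairs (λ u v → r v u) ≡ countPairs r
  countPairs-transpose r = ∑-comm (λ u v → 𝟙 (r v u))

  countPairs-false : countPairs {n} (λ _ _ → false) ≡ 0
  countPairs-false = trans (sum-cong-≗ {n} λ _ → sum-replicate-zero n) (sum-replicate-zero n)

  countPairs≡0⇒false : (r : Fin n → Fin n → Bool) → countPairs r ≡ 0 → ∀ u v → r u v ≡ false
  countPairs≡0⇒false r count≡0 u v =
    𝟙≡0 (sum≡0⇒≡0 (𝟙 ∘ r u) (sum≡0⇒≡0 (λ u → ∑[ v < n ] 𝟙 (r u v)) count≡0 u) v)
    where
    𝟙≡0 : ∀ {b} → 𝟙 b ≡ 0 → b ≡ false
    𝟙≡0 {false} _ = refl

countPairs-permute : ∀ {n m} (φ : Fin m ↔ Fin n) (r : Fin n → Fin n → Bool) →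
                     countPairs r ≡ countPairs (λ u v → r (Inverse.to φ u) (Inverse.to φ v))
countPairs-permute {n} {m} φ r = begin
  ∑[ u < n ] ∑[ v < n ] 𝟙 (r u v)            ≡⟨ ∑-permute (λ u → ∑[ v < n ] 𝟙 (r u v)) φ ⟩
  ∑[ u < m ] ∑[ v < n ] 𝟙 (r (to u) v)       ≡⟨ sum-cong-≗ (λ u → ∑-permute (𝟙 ∘ r (to u)) φ) ⟩
  ∑[ u < m ] ∑[ v < m ] 𝟙 (r (to u) (to v))  ∎
  where open Inverse φ using (to); open ≡-Reasoning

same-refl : ∀ {n} (u : Fin n) → same u u ≡ true
same-refl u with u ≟ u
... | yes _   = refl
... | no  u≢u = contradiction refl u≢u

same-≢ : ∀ {n} {u v : Fin n} → u ≢ v → same u v ≡ false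
same-≢ {u = u} {v} u≢v with u ≟ v
... | yes u≡v = contradiction u≡v u≢v
... | no  _   = refl

same⇒≡ : ∀ {n} {u v : Fin n} → same u v ≡ true → u ≡ v
same⇒≡ {u = u} {v} _ with u ≟ v
... | yes u≡v = u≡v

same-injective : ∀ {n m} {f : Fin n → Fin m} → (∀ {v w} → f v ≡ f w → v ≡ w) →
                 ∀ v w → same (f v) (f w) ≡ same v w
same-injective {f = f} f-injective v w with v ≟ w
... | yes refl = same-refl (f v)
... | no  v≢w  = same-≢ (v≢w ∘ f-injective)

∑-same : ∀ {n} (y : Fin n) → ∑[ v < n ] 𝟙 (same v y) ≡ 1
∑-same {suc n} fzero    = cong suc (sum-replicate-zero n)
∑-same {suc n} (fsuc y) =
  trans (sum-cong-≗ λ v → cong 𝟙 (same-injective Fin.suc-injective v y)) (∑-same y)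

isPair : ∀ {n} → Fin n → Fin n → Fin n → Fin n → Bool
isPair x y u v = (same u x ∧ same v y) ∨ (same u y ∧ same v x)

countPairs-point : ∀ {n} (x y : Fin n) → countPairs (λ u v → same u x ∧ same v y) ≡ 1
countPairs-point {n} x y = trans (sum-cong-≗ λ u → row (same u x)) (∑-same x)
  where
  row : ∀ b → ∑[ v < n ] 𝟙 (b ∧ same v y) ≡ 𝟙 b
  row true  = ∑-same y
  row false = sum-replicate-zero n

countPairs-isPair : ∀ {n} {x y : Fin n} → x ≢ y → countPairs (isPair x y) ≡ 2
countPairs-isPair {n} {x} {y} x≢y = begin
  countPairs (isPair x y)
    ≡⟨ countPairs-+ disjoint ⟨
  countPairs (λ u v → same u x ∧ same v y) + countPairs (λ u v → same u y ∧ same v x)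
    ≡⟨ cong₂ _+_ (countPairs-point x y) (countPairs-point y x) ⟩
  2 ∎
  where
  open ≡-Reasoning
  disjoint : ∀ u v → 𝟙 (same u x ∧ same v y) + 𝟙 (same u y ∧ same v x) ≡ 𝟙 (isPair x y u v)
  disjoint u v with same u x in u≡x | same u y in u≡y
  ... | true  | true  = contradiction (trans (≡.sym (same⇒≡ u≡x)) (same⇒≡ u≡y)) x≢y
  ... | true  | false = trans (+-identityʳ _) (cong 𝟙 (≡.sym (∨-identityʳ _)))
  ... | false | _     = refl

e≡countPairs : ∀ {n} (G : Graph n) → e G ≡ countPairs (λ u v → adj G u v ∧ (toℕ u <ᵇ toℕ v))
e≡countPairs G =
  trans (ΣFin≡sum (λ u → ΣFin (λ v → 𝟙 (adj G u v ∧ (toℕ u <ᵇ toℕ v)))))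
        (sum-cong-≗ λ u → ΣFin≡sum (λ v → 𝟙 (adj G u v ∧ (toℕ u <ᵇ toℕ v))))

countPairs-adj : ∀ {n} (G : Graph n) → countPairs (adj G) ≡ e G + e G
countPairs-adj {n} G = begin
  countPairs (adj G)                                 ≡⟨ countPairs-+ split ⟨
  countPairs below + countPairs (λ u v → below v u)  ≡⟨ cong (countPairs below +_) (countPairs-transpose below) ⟩
  countPairs below + countPairs below                ≡⟨ cong₂ _+_ (e≡countPairs G) (e≡countPairs G) ⟨
  e G + e G                                          ∎
  where
  open ≡-Reasoning
  below : Fin n → Fin n → Bool
  below u v = adj G u v ∧ (toℕ u <ᵇ toℕ v)
  split : ∀ u v → 𝟙 (adj G u v ∧ (toℕ u <ᵇ toℕ v)) + 𝟙 (adj G v u ∧ (toℕ v <ᵇ toℕ u)) ≡ 𝟙 (adj G u v)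
  split u v with toℕ u <ᵇ toℕ v | <ᵇ-reflects-< (toℕ u) (toℕ v)
               | toℕ v <ᵇ toℕ u | <ᵇ-reflects-< (toℕ v) (toℕ u)
  ... | true  | ofʸ u<v | true  | ofʸ v<u = contradiction v<u (<⇒≯ u<v)
  ... | true  | _       | false | _       rewrite ∧-identityʳ (adj G u v) | ∧-zeroʳ (adj G v u) = +-identityʳ _
  ... | false | _       | true  | _       rewrite ∧-identityʳ (adj G v u) | ∧-zeroʳ (adj G u v) = cong 𝟙 (sym G v u)
  ... | false | ofⁿ u≮v | false | ofⁿ v≮u with Fin.toℕ-injective (≤-antisym (≮⇒≥ v≮u) (≮⇒≥ u≮v))
  ...   | refl rewrite irrefl G u = refl

-- Edge counts

∧-≡true⁻ : ∀ {a b} → a ∧ b ≡ true → a ≡ true × b ≡ true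
∧-≡true⁻ {true} b≡true = refl , b≡true

∧-≡true⁺ : ∀ {a b} → a ≡ true → b ≡ true → a ∧ b ≡ true
∧-≡true⁺ refl b≡true = b≡true

∨-≡true⁻ : ∀ {a b} → a ∨ b ≡ true → a ≡ true ⊎ b ≡ true
∨-≡true⁻ {true}  _      = inj₁ refl
∨-≡true⁻ {false} b≡true = inj₂ b≡true

e-additive : ∀ {n m k} {A : Graph n} {B : Graph m} {C : Graph k} →
             countPairs (adj A) + countPairs (adj B) ≡ countPairs (adj C) → e A + e B ≡ e C
e-additive {A = A} {B} {C} eq = halve-sum (e A) (e B) (e C) (begin
  (e A + e A) + (e B + e B)                ≡⟨ cong₂ _+_ (countPairs-adj A) (countPairs-adj B) ⟨
  countPairs (adj A) + countPairs (adj B)  ≡⟨ eq ⟩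
  countPairs (adj C)                       ≡⟨ countPairs-adj C ⟩
  e C + e C                                ∎)
  where open ≡-Reasoning

e-∖ : ∀ {n} (H M : Graph n) → M ⊆ H → e (H ∖ M) + e M ≡ e H
e-∖ H M M⊆H = e-additive {A = H ∖ M} {M} {H} (countPairs-∖ (adj H) (adj M) M⊆H)

e-∖-cancel : ∀ {n d} (G M N : Graph n) → M ⊆ G → N ⊆ G →
             e (G ∖ N) ≡ d + e (G ∖ M) → e M ≡ d + e N
e-∖-cancel {d = d} G M N M⊆G N⊆G eq = ≡.sym (+-cancelˡ-≡ (e (G ∖ M)) _ _ (begin
  e (G ∖ M) + (d + e N)  ≡⟨ xy∙z≈y∙xz d (e (G ∖ M)) (e N) ⟨
  d + e (G ∖ M) + e N    ≡⟨ cong (_+ e N) eq ⟨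
  e (G ∖ N) + e N        ≡⟨ e-∖ G N N⊆G ⟩
  e G                    ≡⟨ e-∖ G M M⊆G ⟨
  e (G ∖ M) + e M        ∎))
  where open ≡-Reasoning

e-mono : ∀ {n} (M N : Graph n) → M ⊆ N → e M ≤ e N
e-mono M N M⊆N = subst (e M ≤_) (e-∖ N M M⊆N) (m≤n+m (e M) (e (N ∖ M)))

edge-≢ : ∀ {n} (G : Graph n) {x y : Fin n} → adj G x y ≡ true → x ≢ y
edge-≢ G {x} xy refl = contradiction (trans (≡.sym (irrefl G x)) xy) λ ()

isPair⇒≡ : ∀ {n} {x y u v : Fin n} → isPair x y u v ≡ true → (u ≡ x × v ≡ y) ⊎ (u ≡ y × v ≡ x)
isPair⇒≡ uv with ∨-≡true⁻ uv
... | inj₁ xy = let (u≡x , v≡y) = ∧-≡true⁻ xy in inj₁ (same⇒≡ u≡x , same⇒≡ v≡y)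
... | inj₂ yx = let (u≡y , v≡x) = ∧-≡true⁻ yx in inj₂ (same⇒≡ u≡y , same⇒≡ v≡x)

-- delEdge G x y has the adjacency of G ∖ singleEdge x≢y, so the lemmas about _∖_ apply to it.
singleEdge : ∀ {n} {x y : Fin n} → x ≢ y → Graph n
adj    (singleEdge {x = x} {y} _) = isPair x y
sym    (singleEdge {x = x} {y} _) u v = trans
  (∨-comm (same u x ∧ same v y) (same u y ∧ same v x))
  (cong₂ _∨_ (∧-comm (same u y) (same v x)) (∧-comm (same u x) (same v y)))
irrefl (singleEdge {x = x} {y} x≢y) u with same u x in u≡x | same u y in u≡y
... | true  | true  = contradiction (trans (≡.sym (same⇒≡ u≡x)) (same⇒≡ u≡y)) x≢y
... | true  | false = refl
... | false | true  = refl
... | false | false = refl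

singleEdge-⊆ : ∀ {n} (G : Graph n) {x y : Fin n} (xy : adj G x y ≡ true) → singleEdge (edge-≢ G xy) ⊆ G
singleEdge-⊆ G {x} {y} xy u v uv with isPair⇒≡ {x = x} {y} {u} {v} uv
... | inj₁ (refl , refl) = xy
... | inj₂ (refl , refl) = trans (sym G _ _) xy

singleEdge-disjoint : ∀ {n} (M : Graph n) {x y : Fin n} (x≢y : x ≢ y) → adj M x y ≡ false →
                      ∀ u v → adj M u v ≡ true → adj (singleEdge x≢y) u v ≡ false
singleEdge-disjoint M {x} {y} _ xy∉M u v uv with isPair x y u v in pair
... | false = refl
... | true with isPair⇒≡ {x = x} {y} {u} {v} pair
...   | inj₁ (refl , refl) = contradiction (trans (≡.sym xy∉M) uv) λ ()
...   | inj₂ (refl , refl) = contradiction (trans (≡.sym xy∉M) (trans (sym M x y) uv)) λ ()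

e-singleEdge : ∀ {n} {x y : Fin n} (x≢y : x ≢ y) → e (singleEdge x≢y) ≡ 1
e-singleEdge x≢y = half-injective (trans (≡.sym (countPairs-adj (singleEdge x≢y))) (countPairs-isPair x≢y))

e-delEdge : ∀ {n} (G : Graph n) {x y : Fin n} → adj G x y ≡ true → suc (e (delEdge G x y)) ≡ e G
e-delEdge G {x} {y} xy = begin
  suc (e (delEdge G x y))  ≡⟨ +-comm 1 _ ⟩
  e (delEdge G x y) + 1    ≡⟨ cong (e (delEdge G x y) +_) (e-singleEdge (edge-≢ G xy)) ⟨
  e (delEdge G x y) + e K  ≡⟨ e-∖ G K (singleEdge-⊆ G xy) ⟩
  e G                      ∎
  where K = singleEdge (edge-≢ G xy); open ≡-Reasoning

edge? : ∀ {n} (G : Graph n) → (∃₂ λ u v → adj G u v ≡ true) ⊎ (∀ u v → adj G u v ≡ false)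
edge? G with Fin.any? (λ u → Fin.any? (λ v → adj G u v Bool.≟ true))
... | yes (u , v , uv) = inj₁ (u , v , uv)
... | no  ¬edge        = inj₂ λ u v → ¬-not (λ uv → ¬edge (u , v , uv))

e≡0⇒edgeless : ∀ {n} (G : Graph n) → e G ≡ 0 → ∀ u v → adj G u v ≡ false
e≡0⇒edgeless G e≡0 = countPairs≡0⇒false (adj G) (trans (countPairs-adj G) (cong₂ _+_ e≡0 e≡0))

edge-of-e≡suc : ∀ {n k} (G : Graph n) → e G ≡ suc k → ∃₂ λ u v → adj G u v ≡ true
edge-of-e≡suc {n} G e≡suc with edge? G
... | inj₁ edge     = edge
... | inj₂ edgeless = contradiction (trans (≡.sym e≡suc) e≡0) λ ()
  where
  e≡0 : e G ≡ 0
  e≡0 = half-injective (trans (≡.sym (countPairs-adj G))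
                              (trans (countPairs-cong edgeless) (countPairs-false {n})))

edge-outside : ∀ {n} (M N : Graph n) → e N < e M → ∃₂ λ p q → adj M p q ≡ true × adj N p q ≡ false
edge-outside M N eN<eM with edge? (M ∖ N)
... | inj₁ (p , q , pq) = let (pq∈M , pq∉N) = ∧-≡true⁻ pq in p , q , pq∈M , not-injective {y = false} pq∉N
... | inj₂ none = contradiction (e-mono M N M⊆N) (<⇒≱ eN<eM)
  where
  M⊆N : M ⊆ N
  M⊆N u v uv with adj N u v in uv∈N
  ... | true  = refl
  ... | false = contradiction (trans (≡.sym (none u v)) (∧-≡true⁺ uv (cong not uv∈N))) λ ()

-- Isomorphisms

infix 4 _≐_

_≐_ : ∀ {n} → Graph n → Graph n → Set
A ≐ B = ∀ u v → adj A u v ≡ adj B u v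

≐-sym : ∀ {n} {A B : Graph n} → A ≐ B → B ≐ A
≐-sym A≐B u v = ≡.sym (A≐B u v)

≐⇒≅ : ∀ {n} {A B : Graph n} → A ≐ B → A ≅ B
≐⇒≅ A≐B = ↔-id _ , A≐B

≅-sym : ∀ {n m} {A : Graph n} {B : Graph m} → A ≅ B → B ≅ A
≅-sym {A = A} {B} (φ , A≅B) = ↔-sym φ , λ u v → ≡.sym (begin
  adj A (from u) (from v)            ≡⟨ A≅B (from u) (from v) ⟩
  adj B (to (from u)) (to (from v))  ≡⟨ cong₂ (adj B) (strictlyInverseˡ u) (strictlyInverseˡ v) ⟩
  adj B u v                          ∎)
  where open Inverse φ; open ≡-Reasoning

≅-trans : ∀ {n m k} {A : Graph n} {B : Graph m} {C : Graph k} → A ≅ B → B ≅ C → A ≅ C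
≅-trans (φ , A≅B) (ψ , B≅C) = ψ ↔-∘ φ , λ u v → trans (A≅B u v) (B≅C (Inverse.to φ u) (Inverse.to φ v))

-- The graphs of an isomorphism are not determined by its type (_≅_ is not injective),
-- so chains name every intermediate graph.
module ≅-Reasoning where

  infix  1 begin_
  infixr 2 _≅⟨_⟩_ _≐⟨_⟩_
  infix  3 _∎

  data _IsoTo_ {n m} (A : Graph n) (B : Graph m) : Set where
    relTo : A ≅ B → A IsoTo B

  begin_ : ∀ {n m} {A : Graph n} {B : Graph m} → A IsoTo B → A ≅ B
  begin relTo A≅B = A≅B

  _≅⟨_⟩_ : ∀ {n m k} (A : Graph n) {B : Graph m} {C : Graph k} → A ≅ B → B IsoTo C → A IsoTo C
  _≅⟨_⟩_ A {B} {C} A≅B (relTo B≅C) = relTo (≅-trans {A = A} {B} {C} A≅B B≅C)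

  _≐⟨_⟩_ : ∀ {n k} (A : Graph n) {B : Graph n} {C : Graph k} → A ≐ B → B IsoTo C → A IsoTo C
  _≐⟨_⟩_ A {B} A≐B B≅C = A ≅⟨ ≐⇒≅ {A = A} {B} A≐B ⟩ B≅C

  _∎ : ∀ {n} (A : Graph n) → A IsoTo A
  A ∎ = relTo (≐⇒≅ {A = A} {A} λ _ _ → refl)

e-resp-≅ : ∀ {n m} {A : Graph n} {B : Graph m} → A ≅ B → e A ≡ e B
e-resp-≅ {A = A} {B} (φ , A≅B) = half-injective (begin
  e A + e A                                                     ≡⟨ countPairs-adj A ⟨
  countPairs (adj A)                                            ≡⟨ countPairs-cong A≅B ⟩
  countPairs (λ u v → adj B (Inverse.to φ u) (Inverse.to φ v))  ≡⟨ countPairs-permute φ (adj B) ⟨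
  countPairs (adj B)                                            ≡⟨ countPairs-adj B ⟩
  e B + e B                                                     ∎)
  where open ≡-Reasoning

e-resp-≐ : ∀ {n} (A B : Graph n) → A ≐ B → e A ≡ e B
e-resp-≐ A B A≐B = e-resp-≅ {A = A} {B} (≐⇒≅ {A = A} {B} A≐B)

relabel : ∀ {n m} → Fin n ↔ Fin m → Graph n → Graph m
adj    (relabel φ M) u v = adj M (Inverse.from φ u) (Inverse.from φ v)
sym    (relabel φ M) u v = sym M _ _
irrefl (relabel φ M) u   = irrefl M _

module _ {n : ℕ} where

  ∖-⊆ : (G K : Graph n) → (G ∖ K) ⊆ G
  ∖-⊆ G K u v uv = proj₁ (∧-≡true⁻ uv)

  ∖-mono : (G M K : Graph n) → M ⊆ G → (M ∖ K) ⊆ (G ∖ K)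
  ∖-mono G M K M⊆G u v uv = let (m , k) = ∧-≡true⁻ uv in ∧-≡true⁺ (M⊆G u v m) k

  ⊆-∖ : (G M K : Graph n) → M ⊆ G → (∀ u v → adj M u v ≡ true → adj K u v ≡ false) → M ⊆ (G ∖ K)
  ⊆-∖ G M K M⊆G disjoint u v uv rewrite disjoint u v uv = trans (∧-identityʳ (adj G u v)) (M⊆G u v uv)

  ∖-∖-comm : (G K M : Graph n) → (G ∖ K) ∖ M ≐ (G ∖ M) ∖ K
  ∖-∖-comm G K M u v = ∧.xy∙z≈xz∙y (adj G u v) (not (adj K u v)) (not (adj M u v))

  ∖-∖-⊆ : (G K M : Graph n) → K ⊆ M → G ∖ M ≐ (G ∖ K) ∖ (M ∖ K)
  ∖-∖-⊆ G K M K⊆M u v = pointwise (adj G u v) (adj M u v) (adj K u v) (K⊆M u v)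
    where
    pointwise : ∀ g m k → (k ≡ true → m ≡ true) → g ∧ not m ≡ (g ∧ not k) ∧ not (m ∧ not k)
    pointwise false _     _     _   = refl
    pointwise true  m     false _   = cong not (≡.sym (∧-identityʳ m))
    pointwise true  true  true  _   = refl
    pointwise true  false true  k⇒m = contradiction (k⇒m refl) λ ()

Ascending-respˡ : ∀ {n n′ m} (A : Graph n) (A′ : Graph n′) (B : Graph m) →
                  A ≅ A′ → Ascending A′ B → Ascending A B
Ascending-respˡ A A′ B A≅A′ (inj₁ A′≅B) = inj₁ (≅-trans {A = A} {A′} {B} A≅A′ A′≅B)
Ascending-respˡ A A′ B A≅A′ (inj₂ (x , y , xy , A′≅B-xy)) =
  inj₂ (x , y , xy , ≅-trans {A = A} {A′} {delEdge B x y} A≅A′ A′≅B-xy)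

Ascending-respʳ : ∀ {n m} (A : Graph n) (B B′ : Graph m) → B ≐ B′ → Ascending A B → Ascending A B′
Ascending-respʳ A B B′ B≐B′ (inj₁ A≅B) = inj₁ (≅-trans {A = A} {B} {B′} A≅B (≐⇒≅ {A = B} {B′} B≐B′))
Ascending-respʳ A B B′ B≐B′ (inj₂ (x , y , xy , A≅B-xy)) =
  inj₂ (x , y , trans (≡.sym (B≐B′ x y)) xy ,
        ≅-trans {A = A} {delEdge B x y} {delEdge B′ x y} A≅B-xy
          (≐⇒≅ {A = delEdge B x y} {delEdge B′ x y} λ u v → cong (_∧ not (isPair x y u v)) (B≐B′ u v)))

-- Isolated matchings

module _ {n : ℕ} (G M : Graph n) where

  isolated-mono : (G′ M′ : Graph n) → G′ ⊆ G → M′ ⊆ M → M′ ⊆ G′ →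
                  IsolatedMatching G M → IsolatedMatching G′ M′
  isolated-mono G′ M′ G′⊆G M′⊆M M′⊆G′ (_ , isolated) =
    M′⊆G′ , λ u v x y uv xy touches → isolated u v x y (M′⊆M u v uv) (G′⊆G x y xy) touches

  isolated-∖ : (K : Graph n) → IsolatedMatching G M → IsolatedMatching (G ∖ K) (M ∖ K)
  isolated-∖ K im = isolated-mono (G ∖ K) (M ∖ K) (∖-⊆ G K) (∖-⊆ M K) (∖-mono G M K (proj₁ im)) im

  isolated-∖-disjoint : (K : Graph n) → (∀ u v → adj M u v ≡ true → adj K u v ≡ false) →
                        IsolatedMatching G M → IsolatedMatching (G ∖ K) M
  isolated-∖-disjoint K disjoint im =
    isolated-mono (G ∖ K) M (∖-⊆ G K) (λ _ _ uv → uv) (⊆-∖ G M K (proj₁ im) disjoint) im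

  neighbourhood : IsolatedMatching G M → ∀ {a b} → adj M a b ≡ true → ∀ v → adj G a v ≡ same v b
  neighbourhood (M⊆G , isolated) {a} {b} ab v with same v b in v≡b
  ... | true  = subst (λ w → adj G a w ≡ true) (≡.sym (same⇒≡ v≡b)) (M⊆G a b ab)
  ... | false with adj G a v in av
  ...   | false = refl
  ...   | true with isolated a b a v ab av (inj₁ refl)
  ...     | inj₁ (_ , refl) = contradiction (trans (≡.sym v≡b) (same-refl b)) λ ()
  ...     | inj₂ (a≡b , _)  = contradiction a≡b (edge-≢ M ab)

module Relabelled {n m} (A : Graph n) (B : Graph m) (A≅B : A ≅ B) (M : Graph n) where
  private
    φ = proj₁ A≅B
    open Inverse φ

  M′ : Graph m
  M′ = relabel φ M

  M≅M′ : M ≅ M′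
  M≅M′ = φ , λ u v → ≡.sym (cong₂ (adj M) (strictlyInverseʳ u) (strictlyInverseʳ v))

  e-M′ : e M′ ≡ e M
  e-M′ = ≡.sym (e-resp-≅ {A = M} {M′} M≅M′)

  A∖M≅B∖M′ : (A ∖ M) ≅ (B ∖ M′)
  A∖M≅B∖M′ = φ , λ u v → cong₂ (λ a m → a ∧ not m) (proj₂ A≅B u v) (proj₂ M≅M′ u v)

  e-A∖M≡e-B∖M′ : e (A ∖ M) ≡ e (B ∖ M′)
  e-A∖M≡e-B∖M′ = e-resp-≅ {A = A ∖ M} {B ∖ M′} A∖M≅B∖M′

  isolated-M′ : IsolatedMatching A M → IsolatedMatching B M′
  isolated-M′ (M⊆A , isolated) = M′⊆B , isolated′
    where
    adj-from : ∀ x y → adj A (from x) (from y) ≡ adj B x y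
    adj-from x y =
      trans (proj₂ A≅B (from x) (from y)) (cong₂ (adj B) (strictlyInverseˡ x) (strictlyInverseˡ y))
    from-injective : ∀ {x y} → from x ≡ from y → x ≡ y
    from-injective {x} {y} eq = trans (≡.sym (strictlyInverseˡ x)) (trans (cong to eq) (strictlyInverseˡ y))
    M′⊆B : M′ ⊆ B
    M′⊆B u v uv = trans (≡.sym (adj-from u v)) (M⊆A _ _ uv)
    isolated′ : ∀ u v x y → adj M′ u v ≡ true → adj B x y ≡ true → (x ≡ u ⊎ x ≡ v ⊎ y ≡ u ⊎ y ≡ v) →
                (x ≡ u × y ≡ v) ⊎ (x ≡ v × y ≡ u)
    isolated′ u v x y uv xy touches
      with isolated (from u) (from v) (from x) (from y) uv (trans (adj-from x y) xy)
                    (Sum.map (cong from) (Sum.map (cong from) (Sum.map (cong from) (cong from))) touches)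
    ... | inj₁ (x≡u , y≡v) = inj₁ (from-injective x≡u , from-injective y≡v)
    ... | inj₂ (x≡v , y≡u) = inj₂ (from-injective x≡v , from-injective y≡u)

module IsolatedEdgeSwap {n} (G : Graph n) {a b c d : Fin n}
  (a-nbhd : ∀ v → adj G a v ≡ same v b) (b-nbhd : ∀ v → adj G b v ≡ same v a)
  (c-nbhd : ∀ v → adj G c v ≡ same v d) (d-nbhd : ∀ v → adj G d v ≡ same v c)
  (a≢c : a ≢ c) (a≢d : a ≢ d) (b≢c : b ≢ c) (b≢d : b ≢ d) where

  private
    a≢b : a ≢ b
    a≢b = edge-≢ G (trans (a-nbhd b) (same-refl b))

    c≢d : c ≢ d
    c≢d = edge-≢ G (trans (c-nbhd d) (same-refl d))

  σ : Fin n → Fin n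
  σ u = if same u a then c else if same u c then a else if same u b then d else if same u d then b else u

  σa : σ a ≡ c
  σa rewrite same-refl a = refl

  σc : σ c ≡ a
  σc rewrite same-≢ (≢-sym a≢c) | same-refl c = refl

  σb : σ b ≡ d
  σb rewrite same-≢ (≢-sym a≢b) | same-≢ b≢c | same-refl b = refl

  σd : σ d ≡ b
  σd rewrite same-≢ (≢-sym a≢d) | same-≢ (≢-sym c≢d) | same-≢ (≢-sym b≢d) | same-refl d = refl

  σ-fixed : ∀ {u} → u ≢ a → u ≢ b → u ≢ c → u ≢ d → σ u ≡ u
  σ-fixed u≢a u≢b u≢c u≢d rewrite same-≢ u≢a | same-≢ u≢c | same-≢ u≢b | same-≢ u≢d = refl

  private
    data Position (u : Fin n) : Set where
      at-a : u ≡ a → Position u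
      at-b : u ≡ b → Position u
      at-c : u ≡ c → Position u
      at-d : u ≡ d → Position u
      elsewhere : u ≢ a → u ≢ b → u ≢ c → u ≢ d → Position u

    position : ∀ u → Position u
    position u with u ≟ a | u ≟ b | u ≟ c | u ≟ d
    ... | yes u≡a | _       | _       | _       = at-a u≡a
    ... | no _    | yes u≡b | _       | _       = at-b u≡b
    ... | no _    | no _    | yes u≡c | _       = at-c u≡c
    ... | no _    | no _    | no _    | yes u≡d = at-d u≡d
    ... | no u≢a  | no u≢b  | no u≢c  | no u≢d  = elsewhere u≢a u≢b u≢c u≢d

  σ-involutive : ∀ u → σ (σ u) ≡ u
  σ-involutive u with position u
  ... | at-a refl = trans (cong σ σa) σc
  ... | at-b refl = trans (cong σ σb) σd
  ... | at-c refl = trans (cong σ σc) σa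
  ... | at-d refl = trans (cong σ σd) σb
  ... | elsewhere u≢a u≢b u≢c u≢d = trans (cong σ (σ-fixed u≢a u≢b u≢c u≢d)) (σ-fixed u≢a u≢b u≢c u≢d)

  same-σ : ∀ v w → same (σ v) (σ w) ≡ same v w
  same-σ = same-injective λ {v} {w} σv≡σw →
    trans (≡.sym (σ-involutive v)) (trans (cong σ σv≡σw) (σ-involutive w))

  -- The only neighbour of an endpoint is its partner, and σ maps partners to partners.
  preserves-at : ∀ {w w′ z z′} → σ w ≡ z → σ w′ ≡ z′ →
                 (∀ v → adj G w v ≡ same v w′) → (∀ v → adj G z v ≡ same v z′) →
                 ∀ v → adj G w v ≡ adj G (σ w) (σ v)
  preserves-at {w} {w′} refl refl w-nbhd σw-nbhd v = begin
    adj G w v          ≡⟨ w-nbhd v ⟩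
    same v w′          ≡⟨ same-σ v w′ ⟨
    same (σ v) (σ w′)  ≡⟨ σw-nbhd (σ v) ⟨
    adj G (σ w) (σ v)  ∎
    where open ≡-Reasoning

  endpoint-or-fixed : ∀ u → (∀ v → adj G u v ≡ adj G (σ u) (σ v)) ⊎ σ u ≡ u
  endpoint-or-fixed u with position u
  ... | at-a refl = inj₁ (preserves-at σa σb a-nbhd c-nbhd)
  ... | at-b refl = inj₁ (preserves-at σb σa b-nbhd d-nbhd)
  ... | at-c refl = inj₁ (preserves-at σc σd c-nbhd a-nbhd)
  ... | at-d refl = inj₁ (preserves-at σd σc d-nbhd b-nbhd)
  ... | elsewhere u≢a u≢b u≢c u≢d = inj₂ (σ-fixed u≢a u≢b u≢c u≢d)

  σ-preserves : ∀ u v → adj G u v ≡ adj G (σ u) (σ v)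
  σ-preserves u v with endpoint-or-fixed u | endpoint-or-fixed v
  ... | inj₁ at-u | _         = at-u v
  ... | inj₂ _    | inj₁ at-v = trans (sym G u v) (trans (at-v u) (sym G (σ v) (σ u)))
  ... | inj₂ σu≡u | inj₂ σv≡v rewrite σu≡u | σv≡v = refl

  automorphism : G ≅ G
  automorphism = mk↔ₛ′ σ σ σ-involutive σ-involutive , σ-preserves

-- If ab ∉ N, the isolated edges ab and cd are disjoint and swapping them works; otherwise the
-- identity does.
automorphism-onto-edge : ∀ {n} (G M N : Graph n) {a b c d : Fin n} →
  IsolatedMatching G M → IsolatedMatching G N → adj M a b ≡ true → adj N c d ≡ true →
  Σ (G ≅ G) λ φ → adj (relabel (proj₁ φ) N) a b ≡ true
automorphism-onto-edge G M N {a} {b} {c} {d} imM imN ab cd with adj N a b in ab∈N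
... | true  = ≐⇒≅ {A = G} {G} (λ _ _ → refl) , ab∈N
... | false = automorphism , subst₂ (λ x y → adj N x y ≡ true) (≡.sym σa) (≡.sym σb) cd
  where
  ba : adj M b a ≡ true
  ba = trans (sym M b a) ab
  dc : adj N d c ≡ true
  dc = trans (sym N d c) cd
  ab∉N : adj N a b ≡ true → ⊥
  ab∉N ab∈N′ = contradiction (trans (≡.sym ab∈N) ab∈N′) λ ()
  ba∉N : adj N b a ≡ true → ⊥
  ba∉N = ab∉N ∘ trans (sym N a b)
  partner : ∀ {x y v} → adj M x y ≡ true → adj N x v ≡ true → v ≡ y
  partner {x} {y} {v} xy xv = same⇒≡ (trans (≡.sym (neighbourhood G M imM xy v)) (proj₁ imN x v xv))
  a≢c : a ≢ c
  a≢c refl = ab∉N (subst (λ v → adj N a v ≡ true) (partner ab cd) cd)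
  a≢d : a ≢ d
  a≢d refl = ab∉N (subst (λ v → adj N a v ≡ true) (partner ab dc) dc)
  b≢c : b ≢ c
  b≢c refl = ba∉N (subst (λ v → adj N b v ≡ true) (partner ba cd) cd)
  b≢d : b ≢ d
  b≢d refl = ba∉N (subst (λ v → adj N b v ≡ true) (partner ba dc) dc)
  open IsolatedEdgeSwap G (neighbourhood G M imM ab) (neighbourhood G M imM ba)
                          (neighbourhood G N imN cd) (neighbourhood G N imN dc) a≢c a≢d b≢c b≢d

-- Removing isolated matchings

∖-≅-of-equal-size : ∀ {n} k (G M N : Graph n) → IsolatedMatching G M → IsolatedMatching G N →
                    e M ≡ k → e N ≡ k → (G ∖ M) ≅ (G ∖ N)
∖-≅-of-equal-size zero G M N _ _ eM≡0 eN≡0 = ≐⇒≅ {A = G ∖ M} {G ∖ N} λ u v →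
  cong (λ m → adj G u v ∧ not m) (trans (e≡0⇒edgeless M eM≡0 u v) (≡.sym (e≡0⇒edgeless N eN≡0 u v)))
∖-≅-of-equal-size (suc k) G M N imM imN eM eN with edge-of-e≡suc M eM | edge-of-e≡suc N eN
... | a , b , ab | c , d , cd with automorphism-onto-edge G M N imM imN ab cd
... | φ , ab∈N′ = begin
  G ∖ M                           ≐⟨ ∖-∖-⊆ G K M (singleEdge-⊆ M ab) ⟩
  delEdge G a b ∖ delEdge M a b   ≅⟨ ∖-≅-of-equal-size k (delEdge G a b) (delEdge M a b) (delEdge N′ a b)
                                       (isolated-∖ G M K imM) (isolated-∖ G N′ K imN′)
                                       (suc-injective (trans (e-delEdge M ab) eM))
                                       (suc-injective (trans (e-delEdge N′ ab∈N′) (trans e-N′ eN))) ⟩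
  delEdge G a b ∖ delEdge N′ a b  ≐⟨ ≐-sym {A = G ∖ N′} {delEdge G a b ∖ delEdge N′ a b}
                                       (∖-∖-⊆ G K N′ (singleEdge-⊆ N′ ab∈N′)) ⟩
  G ∖ N′                          ≅⟨ ≅-sym {A = G ∖ N} {G ∖ N′} G∖N≅G∖N′ ⟩
  G ∖ N                           ∎
  where
  open ≅-Reasoning
  open Relabelled G G φ N
    renaming (M′ to N′; e-M′ to e-N′; A∖M≅B∖M′ to G∖N≅G∖N′; isolated-M′ to isolated-N′)
  K = singleEdge (edge-≢ M ab)
  imN′ : IsolatedMatching G N′
  imN′ = isolated-N′ imN

∖-≅-of-complement-size : ∀ {n} (G M N : Graph n) → IsolatedMatching G M → IsolatedMatching G N →
                         e (G ∖ N) ≡ e (G ∖ M) → (G ∖ M) ≅ (G ∖ N)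
∖-≅-of-complement-size G M N imM imN equal =
  ∖-≅-of-equal-size (e N) G M N imM imN (e-∖-cancel {d = 0} G M N (proj₁ imM) (proj₁ imN) equal) refl

ascending-∖-of-larger : ∀ {n} (G M N : Graph n) → IsolatedMatching G M → IsolatedMatching G N →
                        e M ≡ suc (e N) → Ascending (G ∖ M) (G ∖ N)
ascending-∖-of-larger G M N imM imN eM with edge-outside M N (subst (e N <_) (≡.sym eM) (n<1+n (e N)))
... | p , q , pq∈M , pq∉N = inj₂ (p , q , ∧-≡true⁺ (proj₁ imM p q pq∈M) (cong not pq∉N) , (begin
  G ∖ M                          ≐⟨ ∖-∖-⊆ G K M (singleEdge-⊆ M pq∈M) ⟩
  delEdge G p q ∖ delEdge M p q  ≅⟨ ∖-≅-of-equal-size (e N) (delEdge G p q) (delEdge M p q) N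
                                      (isolated-∖ G M K imM)
                                      (isolated-∖-disjoint G N K
                                        (singleEdge-disjoint N (edge-≢ M pq∈M) pq∉N) imN)
                                      (suc-injective (trans (e-delEdge M pq∈M) eM)) refl ⟩
  delEdge G p q ∖ N              ≐⟨ ∖-∖-comm G K N ⟩
  delEdge (G ∖ N) p q            ∎))
  where
  open ≅-Reasoning
  K = singleEdge (edge-≢ M pq∈M)

ascending-∖ : ∀ {n} (G M N : Graph n) → IsolatedMatching G M → IsolatedMatching G N →
              e (G ∖ N) ≡ suc (e (G ∖ M)) ⊎ e (G ∖ N) ≡ e (G ∖ M) → Ascending (G ∖ M) (G ∖ N)
ascending-∖ G M N imM imN (inj₁ larger) =
  ascending-∖-of-larger G M N imM imN (e-∖-cancel {d = 1} G M N (proj₁ imM) (proj₁ imN) larger)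
ascending-∖ G M N imM imN (inj₂ equal) = inj₁ (∖-≅-of-complement-size G M N imM imN equal)

-- If xy ∈ N, the deleted edge is absorbed into the matching; otherwise N is already an
-- isolated matching of H ∖ xy, of the same size as M.
ascending-delEdge-∖ : ∀ {n} (H N M : Graph n) {x y : Fin n} →
  IsolatedMatching H N → adj H x y ≡ true → IsolatedMatching (delEdge H x y) M →
  e (H ∖ N) ≡ suc (e (delEdge H x y ∖ M)) → Ascending (delEdge H x y ∖ M) (H ∖ N)
ascending-delEdge-∖ H N M {x} {y} imN xy imM larger with adj N x y in xy∈N
... | true = Ascending-respʳ (G ∖ M) (G ∖ N′) (H ∖ N) (≐-sym {A = H ∖ N} {G ∖ N′} H∖N≐G∖N′)
               (ascending-∖ G M N′ imM (isolated-∖ H N K imN)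
                 (inj₁ (trans (e-resp-≐ (G ∖ N′) (H ∖ N) (≐-sym {A = H ∖ N} {G ∖ N′} H∖N≐G∖N′)) larger)))
  where
  G = delEdge H x y
  N′ = delEdge N x y
  K = singleEdge (edge-≢ H xy)
  H∖N≐G∖N′ : H ∖ N ≐ G ∖ N′
  H∖N≐G∖N′ = ∖-∖-⊆ H K N (singleEdge-⊆ N xy∈N)
... | false = inj₂ (x , y , xy∈H∖N , (let open ≅-Reasoning in begin
  G ∖ M                ≅⟨ ∖-≅-of-complement-size G M N imM imN′ equal-size ⟩
  G ∖ N                ≐⟨ ∖-∖-comm H K N ⟩
  delEdge (H ∖ N) x y  ∎))
  where
  G = delEdge H x y
  K = singleEdge (edge-≢ H xy)
  xy∈H∖N : adj (H ∖ N) x y ≡ true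
  xy∈H∖N = ∧-≡true⁺ xy (cong not xy∈N)
  imN′ : IsolatedMatching G N
  imN′ = isolated-∖-disjoint H N K (singleEdge-disjoint N (edge-≢ H xy) xy∈N) imN
  equal-size : e (G ∖ N) ≡ e (G ∖ M)
  equal-size = suc-injective (begin
    suc (e (G ∖ N))                ≡⟨ cong suc (e-resp-≐ (G ∖ N) (delEdge (H ∖ N) x y) (∖-∖-comm H K N)) ⟩
    suc (e (delEdge (H ∖ N) x y))  ≡⟨ e-delEdge (H ∖ N) xy∈H∖N ⟩
    e (H ∖ N)                      ≡⟨ larger ⟩
    suc (e (G ∖ M))                ∎)
    where open ≡-Reasoning

mainTheorem16 : ∀ {n m} (Hi : Graph n) (Hj : Graph m) (Mi : Graph n) (Mj : Graph m) →
    Ascending Hi Hj → IsolatedMatching Hi Mi → IsolatedMatching Hj Mj →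
    (e (Hj ∖ Mj) ≡ suc (e (Hi ∖ Mi)) ⊎ (e (Hj ∖ Mj) ≡ e (Hi ∖ Mi) × Hj ≅ Hi)) →
    Ascending (Hi ∖ Mi) (Hj ∖ Mj)
mainTheorem16 Hi Hj Mi Mj (inj₁ Hi≅Hj) imi imj sizes =
  Ascending-respˡ (Hi ∖ Mi) (Hj ∖ M′) (Hj ∖ Mj) A∖M≅B∖M′
    (ascending-∖ Hj M′ Mj (isolated-M′ imi) imj
      (Sum.map (λ larger → trans larger (cong suc e-A∖M≡e-B∖M′))
               (λ (equal , _) → trans equal e-A∖M≡e-B∖M′) sizes))
  where open Relabelled Hi Hj Hi≅Hj Mi
mainTheorem16 Hi Hj Mi Mj (inj₂ (x , y , xy , Hi≅Hj-xy)) imi imj (inj₁ larger) =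
  Ascending-respˡ (Hi ∖ Mi) (delEdge Hj x y ∖ M′) (Hj ∖ Mj) A∖M≅B∖M′
    (ascending-delEdge-∖ Hj Mj M′ imj xy (isolated-M′ imi) (trans larger (cong suc e-A∖M≡e-B∖M′)))
  where open Relabelled Hi (delEdge Hj x y) Hi≅Hj-xy Mi
mainTheorem16 Hi Hj Mi Mj (inj₂ (x , y , xy , Hi≅Hj-xy)) imi imj (inj₂ (_ , Hj≅Hi)) =
  contradiction (trans (e-delEdge Hj xy) (trans (e-resp-≅ {A = Hj} {Hi} Hj≅Hi)
                                                (e-resp-≅ {A = Hi} {delEdge Hj x y} Hi≅Hj-xy))) 1+n≢n
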